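{- Let $A$ be an $n\times n$ skew-symmetric (real or complex) matrix and let $D$ be a diagonal matrix whose diagonal entries all lie in $\{ -1,1\}$. Then $A$ and $D^{ -1}AD$ are HL-clan-reversal-equivalent.
   Context: $[n]=\{1,\dots,n\}$, $\overline{X}=[n]\setminus X$; $A[X,Y]$ is the submatrix of $A$ with rows in $X$ and columns in $Y$. A subset $X\subseteq[n]$ is an HL-clan of $A$ if both $A[X,\overline{X}]$ and $A[\overline{X},X]$ have rank at most $1$ ($\emptyset$, $[n]$ and singletons are HL-clans). For skew-symmetric $A=[a_{ij}]$ and $X\subseteq[n]$, $Inv(X,A)=[t_{ij}]$ with $t_{ij}=-a_{ij}$ if $i,j\in X$ and $t_{ij}=a_{ij}$ otherwise. $A,B$ are HL-clan-reversal-equivalent if there is a sequence $A_0=A,\dots,A_m=B$ of $n\times n$ skew-symmetric matrices with $A_{k+1}=Inv(X_k,A_k)$ for some HL-clan $X_k$ of $A_k$, for $k=0,\dots,m-1$. -}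

module Defs where

open import Level using (Level; _⊔_; suc)
open import Algebra.Bundles using (CommutativeRing)
open import Data.Nat using (ℕ; zero) renaming (suc to sucℕ)
open import Data.Fin using (Fin) renaming (zero to fz; suc to fs)
open import Data.Fin.Subset using (Subset; _∈_; _∉_)
open import Data.Vec using (lookup)
open import Data.Bool using (Bool; true; false; _∧_; if_then_else_)
open import Data.Product using (Σ; ∃; _×_; _,_)
open import Data.Sum using (_⊎_)
open import Relation.Nullary using (¬_)
open import Relation.Binary.PropositionalEquality using (_≡_)
open import Relation.Binary.Construct.Closure.ReflexiveTransitive using (Star)

record Field (c ℓ : Level) : Set (suc (c ⊔ ℓ)) where
  field
    commutativeRing : CommutativeRing c ℓ
  open CommutativeRing commutativeRing public
  field
    0≉1     : ¬ (0# ≈ 1#)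
    inverse : ∀ x → ¬ (x ≈ 0#) → ∃ λ y → x * y ≈ 1#

module _ {c ℓ : Level} (F : Field c ℓ) where
  open Field F

  natCast : ℕ → Carrier
  natCast zero = 0#
  natCast (sucℕ m) = 1# + natCast m

  -- characteristic zero (as for ℝ and ℂ)
  CharZero : Set ℓ
  CharZero = ∀ m → ¬ (natCast (sucℕ m) ≈ 0#)

  ∑ : ∀ k → (Fin k → Carrier) → Carrier
  ∑ zero f = 0#
  ∑ (sucℕ k) f = f fz + ∑ k (λ i → f (fs i))

  Mat : ℕ → Set c
  Mat n = Fin n → Fin n → Carrier

  _≋_ : ∀ {n} → Mat n → Mat n → Set ℓ
  A ≋ B = ∀ i j → A i j ≈ B i j

  mul : ∀ {n} → Mat n → Mat n → Mat n
  mul {n} A B i j = ∑ n (λ k → A i k * B k j)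

  identity : ∀ {n} → Mat n
  identity i j with i Data.Fin.≟ j
  ... | Relation.Nullary.yes _ = 1#
  ... | Relation.Nullary.no _ = 0#

  SkewSymmetric : ∀ {n} → Mat n → Set ℓ
  SkewSymmetric A = ∀ i j → A j i ≈ - A i j

  IsSignDiagonal : ∀ {n} → Mat n → Set ℓ
  IsSignDiagonal D =
    (∀ i j → ¬ (i ≡ j) → D i j ≈ 0#) × (∀ i → D i i ≈ 1# ⊎ D i i ≈ - 1#)

  IsInverse : ∀ {n} → Mat n → Mat n → Set ℓ
  IsInverse E D = (mul E D ≋ identity) × (mul D E ≋ identity)

  -- rank at most k for a matrix with rows indexed by R and columns by C
  -- (rank = least inner dimension of a factorisation M = U V)
  RankAtMost : ∀ {r s} {R : Set r} {C : Set s} → ℕ → (R → C → Carrier) → Set (c ⊔ ℓ ⊔ r ⊔ s)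
  RankAtMost {R = R} {C = C} k M =
    Σ (R → Fin k → Carrier) λ U → Σ (Fin k → C → Carrier) λ V →
      ∀ r s → M r s ≈ ∑ k (λ l → U r l * V l s)

  sub : ∀ {n} → Mat n → (X Y : Fin n → Set) → Σ (Fin n) X → Σ (Fin n) Y → Carrier
  sub A X Y (i , _) (j , _) = A i j

  HLClan : ∀ {n} → Subset n → Mat n → Set (c ⊔ ℓ)
  HLClan X A =
    RankAtMost 1 (sub A (_∈ X) (_∉ X)) × RankAtMost 1 (sub A (_∉ X) (_∈ X))

  Inv : ∀ {n} → Subset n → Mat n → Mat n
  Inv X A i j = if lookup X i ∧ lookup X j then - A i j else A i j

  HLStep : ∀ {n} → Mat n → Mat n → Set (c ⊔ ℓ)
  HLStep {n} A B =
    SkewSymmetric A × SkewSymmetric B ×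
    Σ (Subset n) λ X → HLClan X A × (B ≋ Inv X A)

  HLClanReversalEquivalent : ∀ {n} → Mat n → Mat n → Set (c ⊔ ℓ)
  HLClanReversalEquivalent = Star HLStep

-- Conjugating by a diagonal sign matrix negates a_ij exactly when d_i ≠ d_j, so it
-- is a composite of "flip row and column k" operations. Flipping k is itself two
-- HL-clan reversals: reversing the complement of {k} (an HL-clan, since A[X, {k}]
-- and A[{k}, X] are a single column and row) and then reversing all of [n]. The
-- only entry this handles wrongly is a_kk, which is harmless because a_kk ≈ -a_kk.
module Submission where

open import Defs
open import Data.Nat using (ℕ; zero; suc)
open import Data.Fin using (Fin) renaming (zero to fz; suc to fs)
open import Data.Fin.Properties using (_≟_; suc-injective)
open import Data.Fin.Subset using (Subset; _∈_; _∉_; ⊤; ⁅_⁆; ∁)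
open import Data.Fin.Subset.Properties using (∈⊤; x∉∁p⇒x∈p; x∈⁅y⁆⇒x≡y)
open import Data.Vec using (lookup)
open import Data.Vec.Properties using (lookup-replicate; lookup-map)
open import Data.Bool using (Bool; true; false; not; _∧_; _xor_; if_then_else_)
open import Data.Bool.Properties using (∧-comm; ∧-identityʳ; ∧-zeroʳ; xor-comm; xor-identityʳ; xor-∧-commutativeRing)
open import Data.Product using (Σ; _,_; proj₁; proj₂)
open import Data.Sum using (_⊎_; inj₁; inj₂)
open import Data.Empty using (⊥-elim)
open import Data.List using (List; []; _∷_; allFin)
open import Data.List.Relation.Unary.Any using (here; there)
import Data.List.Membership.Propositional as List
open import Data.List.Membership.Propositional.Properties using (∈-allFin)
open import Function using (_∘_)
open import Relation.Nullary using (yes; no; does)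
open import Relation.Binary.PropositionalEquality as ≡ using (_≡_; _≢_; _≗_)
open import Relation.Binary.Construct.Closure.ReflexiveTransitive using (ε; _◅_; _◅◅_)
open import Algebra.Bundles using (CommutativeRing)
open import Algebra.Properties.CommutativeSemigroup (CommutativeRing.+-commutativeSemigroup xor-∧-commutativeRing)
  using () renaming (interchange to xor-interchange)
import Algebra.Properties.Ring as RingProperties
import Relation.Binary.Reasoning.Setoid as SetoidReasoning

lookup-⁅⁆ : ∀ {n} (k i : Fin n) → lookup ⁅ k ⁆ i ≡ does (i ≟ k)
lookup-⁅⁆ fz     fz     = ≡.refl
lookup-⁅⁆ fz     (fs i) = lookup-replicate i false
lookup-⁅⁆ (fs k) fz     = ≡.refl
lookup-⁅⁆ (fs k) (fs i) = lookup-⁅⁆ k i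

indicator : ∀ {n} → Fin n → Fin n → Bool
indicator k i = does (i ≟ k)

lookup-∁⁅⁆ : ∀ {n} (k i : Fin n) → lookup (∁ ⁅ k ⁆) i ≡ not (indicator k i)
lookup-∁⁅⁆ k i = ≡.trans (lookup-map i not ⁅ k ⁆) (≡.cong not (lookup-⁅⁆ k i))

split-at : ∀ {n} (σ : Fin n → Bool) (k i : Fin n) →
           σ i ≡ (σ k ∧ indicator k i) xor (not (indicator k i) ∧ σ i)
split-at σ k i with i ≟ k
... | yes ≡.refl = ≡.sym (≡.trans (xor-identityʳ _) (∧-identityʳ (σ k)))
... | no _       = ≡.cong (_xor σ i) (≡.sym (∧-zeroʳ (σ k)))

module _ {c ℓ} (F : Field c ℓ) where
  open Field F
  open RingProperties ring using (-‿involutive; -1*x≈-x)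
  open SetoidReasoning setoid

  ≋-refl : ∀ {n} {A : Mat F n} → _≋_ F A A
  ≋-refl i j = refl

  negateIf : Bool → Carrier → Carrier
  negateIf b x = if b then - x else x

  negateIf-cong : ∀ b {x y} → x ≈ y → negateIf b x ≈ negateIf b y
  negateIf-cong false x≈y = x≈y
  negateIf-cong true  x≈y = -‿cong x≈y

  negateIf-negateIf : ∀ a b x → negateIf a (negateIf b x) ≈ negateIf (a xor b) x
  negateIf-negateIf false b     x = refl
  negateIf-negateIf true  false x = refl
  negateIf-negateIf true  true  x = -‿involutive x

  negateIf-‿ : ∀ b x → negateIf b (- x) ≡ - negateIf b x
  negateIf-‿ false x = ≡.refl
  negateIf-‿ true  x = ≡.refl

  negateIf-1*ˡ : ∀ b x → negateIf b 1# * x ≈ negateIf b x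
  negateIf-1*ˡ false x = *-identityˡ x
  negateIf-1*ˡ true  x = -1*x≈-x x

  negateIf-1*ʳ : ∀ b x → x * negateIf b 1# ≈ negateIf b x
  negateIf-1*ʳ b x = trans (*-comm x _) (negateIf-1*ˡ b x)

  negateBy : ∀ {n} → (Fin n → Fin n → Bool) → Mat F n → Mat F n
  negateBy P A i j = negateIf (P i j) (A i j)

  negateBy-skew : ∀ {n} {A : Mat F n} (P : Fin n → Fin n → Bool) →
                  (∀ i j → P j i ≡ P i j) → SkewSymmetric F A → SkewSymmetric F (negateBy P A)
  negateBy-skew {A = A} P P-sym skew i j = begin
    negateIf (P j i) (A j i)    ≡⟨ ≡.cong (λ b → negateIf b (A j i)) (P-sym i j) ⟩
    negateIf (P i j) (A j i)    ≈⟨ negateIf-cong (P i j) (skew i j) ⟩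
    negateIf (P i j) (- A i j)  ≡⟨ negateIf-‿ (P i j) (A i j) ⟩
    - negateIf (P i j) (A i j)  ∎

  Inv-skew : ∀ {n} (X : Subset n) {A : Mat F n} → SkewSymmetric F A → SkewSymmetric F (Inv F X A)
  Inv-skew X = negateBy-skew (λ i j → lookup X i ∧ lookup X j) (λ i j → ∧-comm (lookup X j) (lookup X i))

  signFlip : ∀ {n} → (Fin n → Bool) → Mat F n → Mat F n
  signFlip σ = negateBy (λ i j → σ i xor σ j)

  signFlip-skew : ∀ {n} (σ : Fin n → Bool) {A : Mat F n} → SkewSymmetric F A → SkewSymmetric F (signFlip σ A)
  signFlip-skew σ = negateBy-skew (λ i j → σ i xor σ j) (λ i j → xor-comm (σ j) (σ i))

  signFlip-cong : ∀ {n} {σ τ : Fin n → Bool} (A : Mat F n) → σ ≗ τ → _≋_ F (signFlip σ A) (signFlip τ A)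
  signFlip-cong A σ≗τ i j = reflexive (≡.cong₂ (λ a b → negateIf (a xor b) (A i j)) (σ≗τ i) (σ≗τ j))

  signFlip-signFlip : ∀ {n} (σ τ : Fin n → Bool) (A : Mat F n) →
                      _≋_ F (signFlip σ (signFlip τ A)) (signFlip (λ i → σ i xor τ i) A)
  signFlip-signFlip σ τ A i j = begin
    negateIf (σ i xor σ j) (negateIf (τ i xor τ j) (A i j))  ≈⟨ negateIf-negateIf (σ i xor σ j) (τ i xor τ j) (A i j) ⟩
    negateIf ((σ i xor σ j) xor (τ i xor τ j)) (A i j)       ≡⟨ ≡.cong (λ b → negateIf b (A i j)) (xor-interchange (σ i) (σ j) (τ i) (τ j)) ⟩
    negateIf ((σ i xor τ i) xor (σ j xor τ j)) (A i j)       ∎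

  ∑-zero : ∀ m (f : Fin m → Carrier) → (∀ l → f l ≈ 0#) → ∑ F m f ≈ 0#
  ∑-zero zero    f f≈0 = refl
  ∑-zero (suc m) f f≈0 = trans (+-cong (f≈0 fz) (∑-zero m (λ l → f (fs l)) (λ l → f≈0 (fs l)))) (+-identityʳ 0#)

  ∑-single : ∀ m (f : Fin m → Carrier) j → (∀ l → l ≢ j → f l ≈ 0#) → ∑ F m f ≈ f j
  ∑-single (suc m) f fz f≈0 =
    trans (+-congˡ (∑-zero m (λ l → f (fs l)) (λ l → f≈0 (fs l) λ ()))) (+-identityʳ (f fz))
  ∑-single (suc m) f (fs j) f≈0 =
    trans (+-cong (f≈0 fz λ ()) (∑-single m (λ l → f (fs l)) j (λ l l≢j → f≈0 (fs l) (l≢j ∘ suc-injective))))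
          (+-identityˡ (f (fs j)))

  OffDiagonalZero : ∀ {n} → Mat F n → Set ℓ
  OffDiagonalZero D = ∀ i j → i ≢ j → D i j ≈ 0#

  mul-diagonalˡ : ∀ {n} {D : Mat F n} → OffDiagonalZero D → ∀ M i j → mul F D M i j ≈ D i i * M i j
  mul-diagonalˡ {n} {D} off M i j =
    ∑-single n (λ l → D i l * M l j) i (λ l l≢i → trans (*-congʳ (off i l (l≢i ∘ ≡.sym))) (zeroˡ _))

  mul-diagonalʳ : ∀ {n} {D : Mat F n} → OffDiagonalZero D → ∀ M i j → mul F M D i j ≈ M i j * D j j
  mul-diagonalʳ {n} {D} off M i j =
    ∑-single n (λ l → M i l * D l j) j (λ l l≢j → trans (*-congˡ (off l j l≢j)) (zeroʳ _))

  ±1 : Carrier → Set ℓ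
  ±1 x = x ≈ 1# ⊎ x ≈ - 1#

  isNegative : ∀ {x} → ±1 x → Bool
  isNegative (inj₁ _) = false
  isNegative (inj₂ _) = true

  ±1≈negateIf : ∀ {x} (p : ±1 x) → x ≈ negateIf (isNegative p) 1#
  ±1≈negateIf (inj₁ x≈1)  = x≈1
  ±1≈negateIf (inj₂ x≈-1) = x≈-1

  ±1-square : ∀ {x} → ±1 x → x * x ≈ 1#
  ±1-square (inj₁ x≈1)  = trans (*-cong x≈1 x≈1) (*-identityˡ 1#)
  ±1-square (inj₂ x≈-1) = trans (*-cong x≈-1 x≈-1) (trans (-1*x≈-x (- 1#)) (-‿involutive 1#))

  ±1-sandwich : ∀ {a b} (p : ±1 a) (q : ±1 b) x → (a * x) * b ≈ negateIf (isNegative p xor isNegative q) x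
  ±1-sandwich {a} {b} p q x = begin
    (a * x) * b                            ≈⟨ *-cong (*-congʳ (±1≈negateIf p)) (±1≈negateIf q) ⟩
    (negateIf s 1# * x) * negateIf t 1#    ≈⟨ negateIf-1*ʳ t _ ⟩
    negateIf t (negateIf s 1# * x)         ≈⟨ negateIf-cong t (negateIf-1*ˡ s x) ⟩
    negateIf t (negateIf s x)              ≈⟨ negateIf-negateIf t s x ⟩
    negateIf (t xor s) x                   ≡⟨ ≡.cong (λ b → negateIf b x) (xor-comm t s) ⟩
    negateIf (s xor t) x                   ∎
    where
    s = isNegative p
    t = isNegative q

  sign-diagonal-left-inverse : ∀ {n} {D E : Mat F n} → IsSignDiagonal F D →
                               _≋_ F (mul F E D) (identity F) → _≋_ F E D
  sign-diagonal-left-inverse {D = D} {E} (off , ±1-diag) ED≋I i k = begin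
    E i k                      ≈⟨ *-identityʳ (E i k) ⟨
    E i k * 1#                 ≈⟨ *-congˡ (±1-square (±1-diag k)) ⟨
    E i k * (D k k * D k k)    ≈⟨ *-assoc (E i k) (D k k) (D k k) ⟨
    (E i k * D k k) * D k k    ≈⟨ *-congʳ (mul-diagonalʳ off E i k) ⟨
    mul F E D i k * D k k      ≈⟨ *-congʳ (ED≋I i k) ⟩
    identity F i k * D k k     ≈⟨ identity-*-diagonal ⟩
    D i k                      ∎
    where
    identity-*-diagonal : identity F i k * D k k ≈ D i k
    identity-*-diagonal with i ≟ k
    ... | yes ≡.refl = *-identityˡ (D i i)
    ... | no i≢k     = trans (zeroˡ (D k k)) (sym (off i k i≢k))

  conjugate-sign-diagonal : ∀ {n} {D E : Mat F n} (A : Mat F n) (sign : IsSignDiagonal F D) →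
                            _≋_ F (mul F E D) (identity F) →
                            _≋_ F (mul F (mul F E A) D) (signFlip (λ i → isNegative (proj₂ sign i)) A)
  conjugate-sign-diagonal {D = D} {E} A sign@(off , ±1-diag) ED≋I i j = begin
    mul F (mul F E A) D i j    ≈⟨ mul-diagonalʳ off (mul F E A) i j ⟩
    mul F E A i j * D j j      ≈⟨ *-congʳ (mul-diagonalˡ offE A i j) ⟩
    (E i i * A i j) * D j j    ≈⟨ *-congʳ (*-congʳ (E≋D i i)) ⟩
    (D i i * A i j) * D j j    ≈⟨ ±1-sandwich (±1-diag i) (±1-diag j) (A i j) ⟩
    signFlip (λ i → isNegative (±1-diag i)) A i j ∎
    where
    E≋D = sign-diagonal-left-inverse sign ED≋I
    offE : OffDiagonalZero E
    offE i j i≢j = trans (E≋D i j) (off i j i≢j)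

  rank≤1-outer : ∀ {r s} {R : Set r} {C : Set s} {M : R → C → Carrier} (u : R → Carrier) (v : C → Carrier) →
                 (∀ x y → M x y ≈ u x * v y) → RankAtMost F 1 M
  rank≤1-outer u v M≈uv = (λ x _ → u x) , (λ _ y → v y) , λ x y → trans (M≈uv x y) (sym (+-identityʳ _))

  HLClan-⊤ : ∀ {n} (A : Mat F n) → HLClan F ⊤ A
  HLClan-⊤ A = rank≤1-outer (λ _ → 0#) (λ _ → 0#) (λ _ (j , j∉⊤) → ⊥-elim (j∉⊤ ∈⊤))
             , rank≤1-outer (λ _ → 0#) (λ _ → 0#) (λ (i , i∉⊤) _ → ⊥-elim (i∉⊤ ∈⊤))

  HLClan-∁⁅⁆ : ∀ {n : ℕ} (k : Fin n) (A : Mat F n) → HLClan F (∁ ⁅ k ⁆) A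
  HLClan-∁⁅⁆ {n} k A = rank≤1-outer (λ (i , _) → A i k) (λ _ → 1#) column
                     , rank≤1-outer (λ _ → 1#) (λ (j , _) → A k j) row
    where
    ≡k : ∀ {j} → j ∉ ∁ ⁅ k ⁆ → j ≡ k
    ≡k j∉ = x∈⁅y⁆⇒x≡y k (x∉∁p⇒x∈p j∉)
    column : ∀ (x : Σ (Fin n) (_∈ ∁ ⁅ k ⁆)) (y : Σ (Fin n) (_∉ ∁ ⁅ k ⁆)) → A (proj₁ x) (proj₁ y) ≈ A (proj₁ x) k * 1#
    column (i , _) (j , j∉) with ≡k j∉
    ... | ≡.refl = sym (*-identityʳ _)
    row : ∀ (x : Σ (Fin n) (_∉ ∁ ⁅ k ⁆)) (y : Σ (Fin n) (_∈ ∁ ⁅ k ⁆)) → A (proj₁ x) (proj₁ y) ≈ 1# * A k (proj₁ y)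
    row (i , i∉) (j , _) with ≡k i∉
    ... | ≡.refl = sym (*-identityˡ _)

  skew-resp-≋ : ∀ {n} {A B : Mat F n} → _≋_ F B A → SkewSymmetric F A → SkewSymmetric F B
  skew-resp-≋ B≋A skew i j = trans (B≋A j i) (trans (skew i j) (-‿cong (sym (B≋A i j))))

  reverse : ∀ {n} {A B : Mat F n} (X : Subset n) → SkewSymmetric F A → HLClan F X A →
            _≋_ F B (Inv F X A) → HLClanReversalEquivalent F A B
  reverse X skew clan B≋ = (skew , skew-resp-≋ B≋ (Inv-skew X skew) , X , clan , B≋) ◅ ε

  Inv-⊤ : ∀ {n} (A : Mat F n) i j → Inv F ⊤ A i j ≡ - A i j
  Inv-⊤ A i j rewrite lookup-replicate i true | lookup-replicate j true = ≡.refl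

  Inv-∁⁅⁆ : ∀ {n} (k : Fin n) (A : Mat F n) i j →
            Inv F (∁ ⁅ k ⁆) A i j ≡ negateIf (not (indicator k i) ∧ not (indicator k j)) (A i j)
  Inv-∁⁅⁆ k A i j rewrite lookup-∁⁅⁆ k i | lookup-∁⁅⁆ k j = ≡.refl

  reach-≋ : ∀ {n} {A B : Mat F n} → SkewSymmetric F A → _≋_ F B A → HLClanReversalEquivalent F A B
  reach-≋ {A = A} {B} skew B≋A =
    reverse ⊤ skew (HLClan-⊤ A) ≋-refl ◅◅ reverse ⊤ (Inv-skew ⊤ skew) (HLClan-⊤ _) B≋⊤⊤A
    where
    B≋⊤⊤A : _≋_ F B (Inv F ⊤ (Inv F ⊤ A))
    B≋⊤⊤A i j = begin
      B i j                        ≈⟨ B≋A i j ⟩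
      A i j                        ≈⟨ -‿involutive (A i j) ⟨
      - - A i j                    ≡⟨ ≡.trans (Inv-⊤ (Inv F ⊤ A) i j) (≡.cong -_ (Inv-⊤ A i j)) ⟨
      Inv F ⊤ (Inv F ⊤ A) i j      ∎

  reach-flip : ∀ {n} {A B : Mat F n} (k : Fin n) → SkewSymmetric F A →
               _≋_ F B (signFlip (indicator k) A) → HLClanReversalEquivalent F A B
  reach-flip {A = A} {B} k skew B≋ =
    reverse (∁ ⁅ k ⁆) skew (HLClan-∁⁅⁆ k A) ≋-refl ◅◅ reverse ⊤ (Inv-skew (∁ ⁅ k ⁆) skew) (HLClan-⊤ _) B≋⊤∁A
    where
    flip≈ : ∀ i j → negateIf (indicator k i xor indicator k j) (A i j)
                  ≈ - negateIf (not (indicator k i) ∧ not (indicator k j)) (A i j)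
    flip≈ i j with i ≟ k | j ≟ k
    ... | yes ≡.refl | yes ≡.refl = skew k k
    ... | yes _      | no _       = refl
    ... | no _       | yes _      = refl
    ... | no _       | no _       = sym (-‿involutive (A i j))
    B≋⊤∁A : _≋_ F B (Inv F ⊤ (Inv F (∁ ⁅ k ⁆) A))
    B≋⊤∁A i j = begin
      B i j                                                              ≈⟨ B≋ i j ⟩
      negateIf (indicator k i xor indicator k j) (A i j)                 ≈⟨ flip≈ i j ⟩
      - negateIf (not (indicator k i) ∧ not (indicator k j)) (A i j)     ≡⟨ ≡.trans (Inv-⊤ (Inv F (∁ ⁅ k ⁆) A) i j) (≡.cong -_ (Inv-∁⁅⁆ k A i j)) ⟨
      Inv F ⊤ (Inv F (∁ ⁅ k ⁆) A) i j                                    ∎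

  reach-flipIf : ∀ {n} {A B : Mat F n} (b : Bool) (k : Fin n) → SkewSymmetric F A →
                 _≋_ F B (signFlip (λ i → b ∧ indicator k i) A) → HLClanReversalEquivalent F A B
  reach-flipIf false k = reach-≋
  reach-flipIf true  k = reach-flip k

  reach-signFlip : ∀ {n} (ks : List (Fin n)) (σ : Fin n → Bool) {A B : Mat F n} → SkewSymmetric F A →
                   (∀ i → σ i ≡ true → i List.∈ ks) → _≋_ F B (signFlip σ A) → HLClanReversalEquivalent F A B
  reach-signFlip [] σ {A} skew supp B≋ = reach-≋ skew (λ i j → trans (B≋ i j) (signFlip-cong A σ≗false i j))
    where
    σ≗false : σ ≗ λ _ → false
    σ≗false i with σ i in σi
    ... | false = ≡.refl
    ... | true with () ← supp i σi
  reach-signFlip (k ∷ ks) σ {A} {B} skew supp B≋ =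
    reach-signFlip ks σ′ skew supp′ ≋-refl ◅◅ reach-flipIf (σ k) k (signFlip-skew σ′ skew) B≋flip
    where
    σ′ : Fin _ → Bool
    σ′ i = not (indicator k i) ∧ σ i
    supp′ : ∀ i → not (indicator k i) ∧ σ i ≡ true → i List.∈ ks
    supp′ i σ′i with i ≟ k | supp i
    ... | no i≢k | supp-i with supp-i σ′i
    ...   | here i≡k = ⊥-elim (i≢k i≡k)
    ...   | there i∈ks = i∈ks
    B≋flip : _≋_ F B (signFlip (λ i → σ k ∧ indicator k i) (signFlip σ′ A))
    B≋flip i j = begin
      B i j                                                   ≈⟨ B≋ i j ⟩
      signFlip σ A i j                                        ≈⟨ signFlip-cong A (split-at σ k) i j ⟩
      signFlip (λ i → (σ k ∧ indicator k i) xor σ′ i) A i j   ≈⟨ signFlip-signFlip (λ i → σ k ∧ indicator k i) σ′ A i j ⟨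
      signFlip (λ i → σ k ∧ indicator k i) (signFlip σ′ A) i j ∎

lemma2p5 : ∀ {c ℓ} (F : Field c ℓ) → CharZero F →
    (n : ℕ) (A D Dinv : Mat F n) →
    SkewSymmetric F A → IsSignDiagonal F D → IsInverse F Dinv D →
    HLClanReversalEquivalent F A (mul F (mul F Dinv A) D)
lemma2p5 F _ n A D Dinv skew sign (DinvD≋I , _) =
  reach-signFlip F (allFin n) (λ i → isNegative F (proj₂ sign i)) skew (λ i _ → ∈-allFin i)
    (conjugate-sign-diagonal F A sign DinvD≋I)
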